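{- If $c\in\mathbb{N}$ and $m\in\mathbb{N}\setminus\{0,1\}$, then the cardinality of $\{S\in\mathcal{L}_m\mid\mathrm{C}(S)=c\}$ is less than or equal to the cardinality of $\{S\in\mathcal{L}_m\mid\mathrm{C}(S)=c+1\}$.
   Context: A numerical semigroup is a subset $S\subseteq\mathbb{N}$ containing $0$, closed under addition, with finite complement in $\mathbb{N}$; $\mathrm{m}(S)=\min(S\setminus\{0\})$. $\mathcal{L}_m$ is the set of numerical semigroups with multiplicity $m$. An ideal of a numerical semigroup $\Delta$ is a nonempty $I\subseteq\Delta$ with $I+\Delta\subseteq I$; $\mathcal{J}(\Delta)$ is the set of numerical semigroups $U$ with $U\setminus\{0\}$ an ideal of $\Delta$; $\mathcal{J}(\mathscr{F})=\bigcup_{\Delta\in\mathscr{F}}\mathcal{J}(\Delta)$; $\mathcal{J}^0(\mathbb{N})=\{\mathbb{N}\}$, $\mathcal{J}^{k+1}(\mathbb{N})=\mathcal{J}(\mathcal{J}^k(\mathbb{N}))$; the complexity is $\mathrm{C}(S)=\min\{k\in\mathbb{N}\mid S\in\mathcal{J}^k(\mathbb{N})\}$. -}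

module Defs where

open import Data.Nat using (ℕ; zero; suc; _+_; _≤_; _<_)
open import Data.Bool using (Bool; true; false)
open import Data.Product using (Σ; _×_; ∃)
open import Relation.Nullary using (¬_)
open import Relation.Binary.PropositionalEquality using (_≡_; _≢_)

Subset : Set
Subset = ℕ → Bool

_∈_ : ℕ → Subset → Set
n ∈ S = S n ≡ true

_≈_ : Subset → Subset → Set
S ≈ T = ∀ n → S n ≡ T n

record IsNumericalSemigroup (S : Subset) : Set where
  field
    zero∈   : 0 ∈ S
    closed  : ∀ a b → a ∈ S → b ∈ S → (a + b) ∈ S
    cofinite : ∃ λ F → ∀ n → F ≤ n → n ∈ S

Multiplicity : Subset → ℕ → Set
Multiplicity S m = (m ≢ 0) × (m ∈ S) × (∀ n → 0 < n → n < m → S n ≡ false)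

IsIdealMinusZero : Subset → Subset → Set
IsIdealMinusZero U Δ =
  (∃ λ n → (n ≢ 0) × n ∈ U)
  × (∀ n → n ≢ 0 → n ∈ U → n ∈ Δ)
  × (∀ a b → a ≢ 0 → a ∈ U → b ∈ Δ → (a + b) ∈ U)

InJ : Subset → Subset → Set
InJ Δ U = IsNumericalSemigroup U × IsIdealMinusZero U Δ

InJPow : ℕ → Subset → Set
InJPow zero U = ∀ n → n ∈ U
InJPow (suc k) U = Σ Subset λ Δ → InJPow k Δ × InJ Δ U

Complexity : Subset → ℕ → Set
Complexity S c = InJPow c S × (∀ k → k < c → ¬ InJPow k S)

Elem : ℕ → ℕ → Set
Elem m c = Σ Subset λ S → IsNumericalSemigroup S × Multiplicity S m × Complexity S c

_≈ᴱ_ : ∀ {m c} → Elem m c → Elem m c → Set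
x ≈ᴱ y = Σ.proj₁ x ≈ Σ.proj₁ y

-- |A| ≤ |B|: an injection between the sets (elements identified up to
-- equality of the underlying subsets of ℕ).
CardLe : ℕ → ℕ → ℕ → ℕ → Set
CardLe m c m' c' = Σ (Elem m c → Elem m' c') λ f →
  (∀ x y → x ≈ᴱ y → f x ≈ᴱ f y) × (∀ x y → f x ≈ᴱ f y → x ≈ᴱ y)

{-# OPTIONS --safe #-}
module Submission where

open import Defs
open import Data.Nat using (ℕ; zero; suc; _+_; _*_; _∸_; _≤_; _<_; _≤ᵇ_; _≤?_; z≤n; s≤s)
open import Data.Nat.Properties
open import Data.Bool using (true; false; _∨_)
open import Data.Bool.Properties using (T-≡)
open import Data.Product using (Σ; _×_; _,_; proj₁; proj₂)
open import Data.Sum using (_⊎_; inj₁; inj₂)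
open import Function using (_∘_)
open import Function.Bundles using (Equivalence)
open import Relation.Nullary using (¬_; yes; no; contradiction)
open import Relation.Binary.PropositionalEquality

-- Let M ≥ 2 and write shift M X = {0} ∪ (M + X). For a numerical semigroup X
-- of multiplicity M, shift M X is again one, and (shift M X) ∖ {0} = M + X is an
-- ideal of X, so C(shift M X) ≤ C(X) + 1. Conversely, if U ∈ J^k(ℕ) then
-- k·a + ℕ ⊆ U for every nonzero a ∈ U; and a semigroup S of multiplicity ≥ M
-- with k·M + ℕ ⊆ S lies in J^k(ℕ), through the chain
-- S ⊆ S ∪ [(k−1)M, ∞) ⊆ … ⊆ S ∪ [0, ∞) = ℕ, each a member of J of the next.
-- Hence shift M X ∈ J^(k+1)(ℕ) forces X ∈ J^k(ℕ): the injective map shift M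
-- raises the complexity by exactly one.

infixl 25 _∪_

-- Opaque, so that unification sees S ∪ T rather than the pointwise S n ∨ T n.
opaque
  _∪_ : Subset → Subset → Subset
  (S ∪ T) n = S n ∨ T n

  upFrom : ℕ → Subset
  upFrom F n = F ≤ᵇ n

opaque
  unfolding _∪_

  ∈-∪⁺ˡ : ∀ {S T n} → n ∈ S → n ∈ S ∪ T
  ∈-∪⁺ˡ n∈S rewrite n∈S = refl

  ∈-∪⁺ʳ : ∀ {S T n} → n ∈ T → n ∈ S ∪ T
  ∈-∪⁺ʳ {S} {n = n} n∈T with S n
  ... | true  = refl
  ... | false = n∈T

  ∈-∪⁻ : ∀ {S T n} → n ∈ S ∪ T → n ∈ S ⊎ n ∈ T
  ∈-∪⁻ {S} {n = n} n∈S∪T with S n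
  ... | true  = inj₁ refl
  ... | false = inj₂ n∈S∪T

opaque
  unfolding upFrom

  ∈-upFrom⁺ : ∀ {F n} → F ≤ n → n ∈ upFrom F
  ∈-upFrom⁺ = Equivalence.to T-≡ ∘ ≤⇒≤ᵇ

  ∈-upFrom⁻ : ∀ {F n} → n ∈ upFrom F → F ≤ n
  ∈-upFrom⁻ {F} {n} = ≤ᵇ⇒≤ F n ∘ Equivalence.from T-≡

ContainsFrom : ℕ → Subset → Set
ContainsFrom F S = ∀ n → F ≤ n → n ∈ S

MultiplicityAtLeast : ℕ → Subset → Set
MultiplicityAtLeast M S = ∀ n → n ≢ 0 → n ∈ S → M ≤ n

multiplicity⇒multiplicityAtLeast : ∀ {S M} → Multiplicity S M → MultiplicityAtLeast M S
multiplicity⇒multiplicityAtLeast {M = M} (_ , _ , below-M∉S) n n≢0 n∈S with M ≤? n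
... | yes M≤n = M≤n
... | no  M≰n = contradiction (trans (sym n∈S) (below-M∉S n (n≢0⇒n>0 n≢0) (≰⇒> M≰n))) λ ()

multiplicity≥2⇒¬InJPow0 : ∀ {S M} → Multiplicity S M → 2 ≤ M → ¬ InJPow 0 S
multiplicity≥2⇒¬InJPow0 (_ , _ , below-M∉S) 2≤M ℕ⊆S =
  contradiction (trans (sym (ℕ⊆S 1)) (below-M∉S 1 ≤-refl 2≤M)) λ ()

+-≤-elim : ∀ {P : ℕ → Set} a F → (∀ r → F ≤ r → P (a + r)) → ∀ n → a + F ≤ n → P n
+-≤-elim {P} a F P[a+_] n a+F≤n = subst P (m+[n∸m]≡n a≤n) (P[a+_] (n ∸ a) F≤n∸a)
  where
  a≤n : a ≤ n
  a≤n = ≤-trans (m≤m+n a F) a+F≤n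
  F≤n∸a : F ≤ n ∸ a
  F≤n∸a = subst (_≤ n ∸ a) (m+n∸m≡n a F) (∸-monoˡ-≤ a a+F≤n)

InJPow⇒containsFrom : ∀ k {U a} → InJPow k U → a ≢ 0 → a ∈ U → ContainsFrom (k * a) U
InJPow⇒containsFrom zero ℕ⊆U _ _ n _ = ℕ⊆U n
InJPow⇒containsFrom (suc k) {a = a} (_ , Δ∈Jᵏ , _ , _ , U⊆Δ , U+Δ⊆U) a≢0 a∈U =
  +-≤-elim a (k * a) λ r ka≤r →
    U+Δ⊆U a r a≢0 a∈U (InJPow⇒containsFrom k Δ∈Jᵏ a≢0 (U⊆Δ a a≢0 a∈U) r ka≤r)

∪upFrom-isNumericalSemigroup : ∀ {S} F → IsNumericalSemigroup S
  → IsNumericalSemigroup (S ∪ upFrom F)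
∪upFrom-isNumericalSemigroup {S} F S-ns = record
  { zero∈    = ∈-∪⁺ˡ zero∈
  ; closed   = closed′
  ; cofinite = F , λ _ → ∈-∪⁺ʳ ∘ ∈-upFrom⁺
  }
  where
  open IsNumericalSemigroup S-ns
  closed′ : ∀ a b → a ∈ S ∪ upFrom F → b ∈ S ∪ upFrom F → (a + b) ∈ S ∪ upFrom F
  closed′ a b a∈ b∈ with ∈-∪⁻ a∈ | ∈-∪⁻ b∈
  ... | inj₁ a∈S | inj₁ b∈S = ∈-∪⁺ˡ (closed a b a∈S b∈S)
  ... | inj₂ F≤a | _        = ∈-∪⁺ʳ (∈-upFrom⁺ (≤-trans (∈-upFrom⁻ F≤a) (m≤m+n a b)))
  ... | inj₁ _   | inj₂ F≤b = ∈-∪⁺ʳ (∈-upFrom⁺ (≤-trans (∈-upFrom⁻ F≤b) (m≤n+m b a)))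

∪upFrom-multiplicityAtLeast : ∀ {S M F} → M ≤ F → MultiplicityAtLeast M S
  → MultiplicityAtLeast M (S ∪ upFrom F)
∪upFrom-multiplicityAtLeast M≤F M≤S n n≢0 n∈ with ∈-∪⁻ n∈
... | inj₁ n∈S = M≤S n n≢0 n∈S
... | inj₂ F≤n = ≤-trans M≤F (∈-upFrom⁻ F≤n)

∈J-∪upFrom : ∀ {S M F} → IsNumericalSemigroup S → MultiplicityAtLeast M S
  → ContainsFrom (M + F) S → InJ (S ∪ upFrom F) S
∈J-∪upFrom {S} {M} {F} S-ns M≤S M+F⊆S =
  S-ns , (suc (M + F) , (λ ()) , M+F⊆S _ (n≤1+n _)) , (λ _ _ → ∈-∪⁺ˡ) , ideal
  where
  open IsNumericalSemigroup S-ns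
  ideal : ∀ a b → a ≢ 0 → a ∈ S → b ∈ S ∪ upFrom F → (a + b) ∈ S
  ideal a b a≢0 a∈S b∈ with ∈-∪⁻ b∈
  ... | inj₁ b∈S = closed a b a∈S b∈S
  ... | inj₂ F≤b = M+F⊆S (a + b) (+-mono-≤ (M≤S a a≢0 a∈S) (∈-upFrom⁻ F≤b))

containsFrom⇒InJPow : ∀ k {S M} → IsNumericalSemigroup S → MultiplicityAtLeast M S
  → ContainsFrom (k * M) S → InJPow k S
containsFrom⇒InJPow zero _ _ ℕ⊆S n = ℕ⊆S n z≤n
containsFrom⇒InJPow (suc j) {S} {M} S-ns M≤S kM⊆S =
  S ∪ upFrom (j * M) , chain j , ∈J-∪upFrom S-ns M≤S kM⊆S
  where
  chain : ∀ i → InJPow i (S ∪ upFrom (i * M))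
  chain zero n = ∈-∪⁺ʳ (∈-upFrom⁺ z≤n)
  chain (suc i) = containsFrom⇒InJPow (suc i)
    (∪upFrom-isNumericalSemigroup (suc i * M) S-ns)
    (∪upFrom-multiplicityAtLeast (m≤m+n M (i * M)) M≤S)
    (λ _ → ∈-∪⁺ʳ ∘ ∈-upFrom⁺)

infixr 30 _⊕_

_⊕_ : ℕ → Subset → Subset
(zero  ⊕ X) n       = X n
(suc k ⊕ X) zero    = false
(suc k ⊕ X) (suc n) = (k ⊕ X) n

⊕-+ : ∀ k X j → (k ⊕ X) (k + j) ≡ X j
⊕-+ zero    X j = refl
⊕-+ (suc k) X j = ⊕-+ k X j

⊕-< : ∀ k X {n} → n < k → (k ⊕ X) n ≡ false
⊕-< (suc k) X {zero}  _         = refl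
⊕-< (suc k) X {suc n} (s≤s n<k) = ⊕-< k X n<k

∈-⊕⁻ : ∀ k X n → n ∈ k ⊕ X → Σ ℕ λ j → n ≡ k + j × j ∈ X
∈-⊕⁻ zero    X n       n∈ = n , refl , n∈
∈-⊕⁻ (suc k) X (suc n) n∈ with ∈-⊕⁻ k X n n∈
... | j , refl , j∈X = j , refl , j∈X

⊕-cong : ∀ k {X Y} → X ≈ Y → k ⊕ X ≈ k ⊕ Y
⊕-cong zero    X≈Y n       = X≈Y n
⊕-cong (suc k) X≈Y zero    = refl
⊕-cong (suc k) X≈Y (suc n) = ⊕-cong k X≈Y n

shift : ℕ → Subset → Subset
shift M X zero    = true
shift M X (suc n) = (M ⊕ X) (suc n)

shift-cong : ∀ M {X Y} → X ≈ Y → shift M X ≈ shift M Y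
shift-cong M X≈Y zero    = refl
shift-cong M X≈Y (suc n) = ⊕-cong M X≈Y (suc n)

module _ {m : ℕ} where
  private
    M : ℕ
    M = suc m

  shift-+ : ∀ X j → shift M X (M + j) ≡ X j
  shift-+ = ⊕-+ M

  shift-injective : ∀ {X Y} → shift M X ≈ shift M Y → X ≈ Y
  shift-injective {X} {Y} shiftX≈shiftY j = begin
    X j               ≡⟨ shift-+ X j ⟨
    shift M X (M + j) ≡⟨ shiftX≈shiftY (M + j) ⟩
    shift M Y (M + j) ≡⟨ shift-+ Y j ⟩
    Y j               ∎
    where open ≡-Reasoning

  M+∈shift : ∀ {X j} → j ∈ X → (M + j) ∈ shift M X
  M+∈shift {X} {j} j∈X = trans (shift-+ X j) j∈X

  ∈-shift⁻ : ∀ {X n} → n ≢ 0 → n ∈ shift M X → Σ ℕ λ j → n ≡ M + j × j ∈ X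
  ∈-shift⁻ {n = zero}  0≢0 _  = contradiction refl 0≢0
  ∈-shift⁻ {X} {suc n} _   n∈ = ∈-⊕⁻ M X (suc n) n∈

  M∈shift : ∀ {X} → 0 ∈ X → M ∈ shift M X
  M∈shift {X} 0∈X = subst (_∈ shift M X) (+-identityʳ M) (M+∈shift 0∈X)

  shift-isNumericalSemigroup : ∀ {X} → IsNumericalSemigroup X → M ∈ X
    → IsNumericalSemigroup (shift M X)
  shift-isNumericalSemigroup {X} X-ns M∈X = record
    { zero∈    = refl
    ; closed   = closed′
    ; cofinite = M + proj₁ cofinite , +-≤-elim M _ λ r → M+∈shift ∘ proj₂ cofinite r
    }
    where
    open IsNumericalSemigroup X-ns
    closed′ : ∀ a b → a ∈ shift M X → b ∈ shift M X → (a + b) ∈ shift M X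
    closed′ zero    b       _  b∈ = b∈
    closed′ (suc a) zero    a∈ _  = subst (_∈ shift M X) (sym (+-identityʳ (suc a))) a∈
    closed′ (suc a) (suc b) a∈ b∈ with ∈-shift⁻ (λ ()) a∈ | ∈-shift⁻ (λ ()) b∈
    ... | i , refl , i∈X | j , refl , j∈X =
      subst (_∈ shift M X) (sym (+-assoc M i (M + j)))
        (M+∈shift (closed i (M + j) i∈X (closed M j M∈X j∈X)))

  shift-multiplicity : ∀ {X} → 0 ∈ X → Multiplicity (shift M X) M
  shift-multiplicity {X} 0∈X = (λ ()) , M∈shift 0∈X , below-M∉shift
    where
    below-M∉shift : ∀ n → 0 < n → n < M → shift M X n ≡ false
    below-M∉shift (suc n) _ n<M = ⊕-< M X n<M

  shift-∈J : ∀ {X} → IsNumericalSemigroup X → M ∈ X → InJ X (shift M X)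
  shift-∈J {X} X-ns M∈X =
    shift-isNumericalSemigroup X-ns M∈X , (M + 0 , (λ ()) , M+∈shift zero∈) , ⊆X , ideal
    where
    open IsNumericalSemigroup X-ns
    ⊆X : ∀ n → n ≢ 0 → n ∈ shift M X → n ∈ X
    ⊆X n n≢0 n∈ with ∈-shift⁻ n≢0 n∈
    ... | j , refl , j∈X = closed M j M∈X j∈X
    ideal : ∀ a b → a ≢ 0 → a ∈ shift M X → b ∈ X → (a + b) ∈ shift M X
    ideal a b a≢0 a∈ b∈X with ∈-shift⁻ a≢0 a∈
    ... | j , refl , j∈X = subst (_∈ shift M X) (sym (+-assoc M j b)) (M+∈shift (closed j b j∈X b∈X))

  InJPow-shift⁻ : ∀ k {X} → IsNumericalSemigroup X → MultiplicityAtLeast M X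
    → InJPow (suc k) (shift M X) → InJPow k X
  InJPow-shift⁻ k {X} X-ns M≤X shiftX∈Jᵏ⁺¹ = containsFrom⇒InJPow k X-ns M≤X kM⊆X
    where
    kM⊆X : ContainsFrom (k * M) X
    kM⊆X n kM≤n = trans (sym (shift-+ X n))
      (InJPow⇒containsFrom (suc k) shiftX∈Jᵏ⁺¹ (λ ()) (M∈shift (IsNumericalSemigroup.zero∈ X-ns))
        (M + n) (+-monoʳ-≤ M kM≤n))

  shift-complexity : ∀ {X c} → IsNumericalSemigroup X → Multiplicity X M → 2 ≤ M
    → Complexity X c → Complexity (shift M X) (suc c)
  shift-complexity {X} {c} X-ns X-mult 2≤M (X∈Jᶜ , X∉J<c) =
    (X , X∈Jᶜ , shift-∈J X-ns (proj₁ (proj₂ X-mult))) , shiftX∉J<c+1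
    where
    shiftX∉J<c+1 : ∀ k → k < suc c → ¬ InJPow k (shift M X)
    shiftX∉J<c+1 zero    _         = multiplicity≥2⇒¬InJPow0
      (shift-multiplicity (IsNumericalSemigroup.zero∈ X-ns)) 2≤M
    shiftX∉J<c+1 (suc k) (s≤s k<c) =
      X∉J<c k k<c ∘ InJPow-shift⁻ k X-ns (multiplicity⇒multiplicityAtLeast X-mult)

corollary39 : (c m : ℕ) → 2 ≤ m → CardLe m c m (suc c)
corollary39 c (suc m) 2≤M = shiftᴱ , shiftᴱ-cong , shiftᴱ-injective
  where
  shiftᴱ : Elem (suc m) c → Elem (suc m) (suc c)
  shiftᴱ (X , X-ns , X-mult , X-cx) =
    shift (suc m) X ,
    shift-isNumericalSemigroup X-ns (proj₁ (proj₂ X-mult)) ,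
    shift-multiplicity (IsNumericalSemigroup.zero∈ X-ns) ,
    shift-complexity X-ns X-mult 2≤M X-cx
  shiftᴱ-cong : ∀ x y → x ≈ᴱ y → shiftᴱ x ≈ᴱ shiftᴱ y
  shiftᴱ-cong _ _ = shift-cong (suc m)
  shiftᴱ-injective : ∀ x y → shiftᴱ x ≈ᴱ shiftᴱ y → x ≈ᴱ y
  shiftᴱ-injective _ _ = shift-injective
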